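{- Let $A$ be a ring, $G$ a group and $H$ a normal subgroup of finite index. For each $\sigma\in G/H$ fix a representative $\tilde\sigma\in\sigma$ and set $h_{\sigma,\tau}=\tilde\sigma\tilde\tau\widetilde{\sigma\tau}^{ -1}\in H$. Then the functor $F:\mathrm{Rep}_A(G)\to\mathcal C_{G,H}$ sending a representation $\pi:G\to\mathrm{GL}(M)$ to $(\pi|_H,\{\Psi_\sigma\})$ with $\Psi_\sigma(m)=\pi(\tilde\sigma)(m)$, and a $G$-homomorphism to itself, is an equivalence of categories.
   Context: $\mathrm{Rep}_A(G)$ is the category of representations of $G$ on finitely generated free $A$-modules. For $g\in G$ and a representation $\rho:H\to\mathrm{GL}(M)$, $g^\ast\rho$ is the representation $h\mapsto\rho(ghg^{ -1})$ on $M$; a homomorphism $\phi:\rho\to\rho'$ is also a homomorphism $g^\ast\phi:g^\ast\rho\to g^\ast\rho'$. The category $\mathcal C_{G,H}$ has objects pairs $(\rho,\{\Psi_\sigma\}_{\sigma\in G/H})$ where $\rho:H\to\mathrm{GL}(M)$ is a representation on a finitely generated free $A$-module and $\Psi_\sigma:\rho\to\tilde\sigma^\ast\rho$ are isomorphisms with $(\tilde\tau^\ast\Psi_\sigma)\circ\Psi_\tau=\rho(h_{\sigma,\tau})\circ\Psi_{\sigma\tau}$ for all $\sigma,\tau\in G/H$; morphisms are $H$-homomorphisms $\Phi:\rho\to\rho'$ with $\Psi'_\sigma\circ\Phi=(\tilde\sigma^\ast\Phi)\circ\Psi_\sigma$ for all $\sigma$. -}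

module Defs where

open import Level using (Level; _⊔_) renaming (suc to lsuc)
open import Data.Nat using (ℕ; zero; suc)
open import Data.Fin using (Fin; zero; suc)
open import Data.Product using (Σ; _,_; proj₁; proj₂; _×_)
open import Relation.Binary.PropositionalEquality using (_≡_; sym)
open import Algebra.Bundles using (Ring; Group)
open import Algebra.Module.Bundles using (LeftModule)

record NormalSubgroup {g ℓg : Level} (G : Group g ℓg) (h : Level)
       : Set (g ⊔ ℓg ⊔ lsuc h) where
  open Group G
  field
    H        : Carrier → Set h
    H-resp   : ∀ {x y} → x ≈ y → H x → H y
    H-ε      : H ε
    H-∙      : ∀ {x y} → H x → H y → H (x ∙ y)
    H-⁻¹     : ∀ {x} → H x → H (x ⁻¹)
    H-normal : ∀ (x : Carrier) {y} → H y → H (x ∙ y ∙ x ⁻¹)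

-- H has finite index k: G/H is identified with Fin k via the class map
-- cls (g and g' lie in the same coset iff g g'^{-1} ∈ H), and for each
-- σ ∈ G/H a representative rep σ ∈ σ is fixed.
record FiniteTransversal {g ℓg h : Level} {G : Group g ℓg}
       (N : NormalSubgroup G h) : Set (g ⊔ ℓg ⊔ h) where
  open Group G
  open NormalSubgroup N
  field
    k         : ℕ
    cls       : Carrier → Fin k
    rep       : Fin k → Carrier
    cls-rep   : ∀ σ → cls (rep σ) ≡ σ
    same→H    : ∀ x y → cls x ≡ cls y → H (x ∙ y ⁻¹)
    H→same    : ∀ x y → H (x ∙ y ⁻¹) → cls x ≡ cls y

module Constructions
  {a ℓa g ℓg h : Level}
  (A : Ring a ℓa) (G : Group g ℓg)
  (N : NormalSubgroup G h) (T : FiniteTransversal N)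
  (m ℓm : Level) where

  private
    module A = Ring A
    module G = Group G
  open NormalSubgroup N
  open FiniteTransversal T

  Mod : Set _
  Mod = LeftModule A m ℓm

  sumᴹ : (M : Mod) → ∀ {n} → (Fin n → LeftModule.Carrierᴹ M) → LeftModule.Carrierᴹ M
  sumᴹ M {zero}  f = LeftModule.0ᴹ M
  sumᴹ M {suc n} f = LeftModule._+ᴹ_ M (f zero) (sumᴹ M (λ i → f (suc i)))

  record FiniteBasis (M : Mod) : Set (a ⊔ ℓa ⊔ m ⊔ ℓm) where
    open LeftModule M
    field
      rank  : ℕ
      e     : Fin rank → Carrierᴹ
      span  : ∀ x → Σ (Fin rank → A.Carrier) λ c → x ≈ᴹ sumᴹ M (λ i → c i *ₗ e i)
      indep : ∀ (c : Fin rank → A.Carrier) → sumᴹ M (λ i → c i *ₗ e i) ≈ᴹ 0ᴹ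
              → ∀ i → c i A.≈ A.0#

  record FGFree : Set (a ⊔ ℓa ⊔ lsuc (m ⊔ ℓm)) where
    field
      mod   : Mod
      basis : FiniteBasis mod

  ∣_∣ : FGFree → Set m
  ∣ M ∣ = LeftModule.Carrierᴹ (FGFree.mod M)

  Eq : (M : FGFree) → ∣ M ∣ → ∣ M ∣ → Set ℓm
  Eq M = LeftModule._≈ᴹ_ (FGFree.mod M)

  record IsLinear (M N : FGFree) (f : ∣ M ∣ → ∣ N ∣) : Set (a ⊔ m ⊔ ℓm) where
    open LeftModule (FGFree.mod M) renaming (_+ᴹ_ to _+M_; _*ₗ_ to _*M_)
    open LeftModule (FGFree.mod N) renaming (_+ᴹ_ to _+N_; _*ₗ_ to _*N_)
    field
      f-cong : ∀ {x y} → Eq M x y → Eq N (f x) (f y)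
      f-+    : ∀ x y → Eq N (f (x +M y)) (f x +N f y)
      f-*    : ∀ (c : A.Carrier) x → Eq N (f (c *M x)) (c *N f x)

  -- objects of Rep_A(G): a group homomorphism G → GL(M), written as an
  -- action of G on M by A-linear maps
  record Rep : Set (a ⊔ ℓa ⊔ g ⊔ ℓg ⊔ lsuc (m ⊔ ℓm)) where
    field
      M       : FGFree
      act     : G.Carrier → ∣ M ∣ → ∣ M ∣
      act-lin : ∀ x → IsLinear M M (act x)
      act-cong : ∀ {x y} → x G.≈ y → ∀ v → Eq M (act x v) (act y v)
      act-ε   : ∀ v → Eq M (act G.ε v) v
      act-∙   : ∀ x y v → Eq M (act (x G.∙ y) v) (act x (act y v))

  record RepHom (π π' : Rep) : Set (a ⊔ g ⊔ m ⊔ ℓm) where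
    private
      module π  = Rep π
      module π' = Rep π'
    field
      map     : ∣ π.M ∣ → ∣ π'.M ∣
      map-lin : IsLinear π.M π'.M map
      map-eqv : ∀ x v → Eq π'.M (map (π.act x v)) (π'.act x (map v))

  HEl : Set (g ⊔ h)
  HEl = Σ G.Carrier H

  conj : G.Carrier → HEl → HEl
  conj x (y , p) = (x G.∙ y G.∙ x G.⁻¹ , H-normal x p)

  _·_ : Fin k → Fin k → Fin k
  σ · τ = cls (rep σ G.∙ rep τ)

  hst : Fin k → Fin k → HEl
  hst σ τ = ( rep σ G.∙ rep τ G.∙ rep (σ · τ) G.⁻¹
            , same→H (rep σ G.∙ rep τ) (rep (σ · τ)) (sym (cls-rep (σ · τ))) )

  record CData : Set (a ⊔ ℓa ⊔ g ⊔ h ⊔ lsuc (m ⊔ ℓm)) where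
    field
      M : FGFree
      ρ : HEl → ∣ M ∣ → ∣ M ∣
      Ψ : Fin k → ∣ M ∣ → ∣ M ∣

  record IsCObj (X : CData) : Set (a ⊔ ℓa ⊔ g ⊔ ℓg ⊔ h ⊔ m ⊔ ℓm) where
    open CData X
    field
      ρ-lin  : ∀ x → IsLinear M M (ρ x)
      ρ-cong : ∀ (x y : HEl) → proj₁ x G.≈ proj₁ y → ∀ v → Eq M (ρ x v) (ρ y v)
      ρ-ε    : ∀ v → Eq M (ρ (G.ε , H-ε) v) v
      ρ-∙    : ∀ (x y : HEl) v →
               Eq M (ρ (proj₁ x G.∙ proj₁ y , H-∙ (proj₂ x) (proj₂ y)) v) (ρ x (ρ y v))
      -- Ψ_σ : ρ → σ̃^*ρ is an H-homomorphism ...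
      Ψ-lin  : ∀ σ → IsLinear M M (Ψ σ)
      Ψ-eqv  : ∀ σ x v → Eq M (Ψ σ (ρ x v)) (ρ (conj (rep σ) x) (Ψ σ v))
      -- ... which is an isomorphism (inverse H-homomorphism σ̃^*ρ → ρ)
      Ψ-inv     : Fin k → ∣ M ∣ → ∣ M ∣
      Ψ-inv-lin : ∀ σ → IsLinear M M (Ψ-inv σ)
      Ψ-inv-eqv : ∀ σ x v → Eq M (Ψ-inv σ (ρ (conj (rep σ) x) v)) (ρ x (Ψ-inv σ v))
      Ψ-inv-l   : ∀ σ v → Eq M (Ψ-inv σ (Ψ σ v)) v
      Ψ-inv-r   : ∀ σ v → Eq M (Ψ σ (Ψ-inv σ v)) v
      -- cocycle condition (τ̃^*Ψ_σ) ∘ Ψ_τ = ρ(h_{σ,τ}) ∘ Ψ_{στ}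
      cocycle : ∀ σ τ v → Eq M (Ψ σ (Ψ τ v)) (ρ (hst σ τ) (Ψ (σ · τ) v))

  CObj : Set _
  CObj = Σ CData IsCObj

  record CHomProps (X Y : CData) (Φ : ∣ CData.M X ∣ → ∣ CData.M Y ∣)
         : Set (a ⊔ g ⊔ h ⊔ m ⊔ ℓm) where
    private
      module X = CData X
      module Y = CData Y
    field
      Φ-lin : IsLinear X.M Y.M Φ
      Φ-eqv : ∀ x v → Eq Y.M (Φ (X.ρ x v)) (Y.ρ x (Φ v))
      Φ-Ψ   : ∀ σ v → Eq Y.M (Y.Ψ σ (Φ v)) (Φ (X.Ψ σ v))

  CHom : CObj → CObj → Set _
  CHom X Y = Σ (∣ CData.M (proj₁ X) ∣ → ∣ CData.M (proj₁ Y) ∣) (CHomProps (proj₁ X) (proj₁ Y))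

  CIso : CObj → CObj → Set _
  CIso X Y = Σ (CHom X Y) λ f → Σ (CHom Y X) λ f' →
             (∀ v → Eq (CData.M (proj₁ X)) (proj₁ f' (proj₁ f v)) v) ×
             (∀ v → Eq (CData.M (proj₁ Y)) (proj₁ f (proj₁ f' v)) v)

  FData : Rep → CData
  FData π = record { M = Rep.M π ; ρ = λ x → Rep.act π (proj₁ x) ; Ψ = λ σ → Rep.act π (rep σ) }

  F-obj-wd : Set _
  F-obj-wd = ∀ π → IsCObj (FData π)

  F-hom-wd : Set _
  F-hom-wd = ∀ π π' (φ : RepHom π π') → CHomProps (FData π) (FData π') (RepHom.map φ)

  module _ (wd₀ : F-obj-wd) (wd₁ : F-hom-wd) where

    F₀ : Rep → CObj
    F₀ π = (FData π , wd₀ π)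

    F₁ : ∀ {π π'} → RepHom π π' → CHom (F₀ π) (F₀ π')
    F₁ {π} {π'} φ = (RepHom.map φ , wd₁ π π' φ)

    record IsEquivalence : Set (a ⊔ ℓa ⊔ g ⊔ ℓg ⊔ h ⊔ lsuc (m ⊔ ℓm)) where
      field
        faithful : ∀ π π' (φ ψ : RepHom π π') →
                   (∀ v → Eq (Rep.M π') (proj₁ (F₁ φ) v) (proj₁ (F₁ ψ) v)) →
                   ∀ v → Eq (Rep.M π') (RepHom.map φ v) (RepHom.map ψ v)
        full     : ∀ π π' (Φ : CHom (F₀ π) (F₀ π')) →
                   Σ (RepHom π π') λ φ → ∀ v → Eq (Rep.M π') (proj₁ (F₁ φ) v) (proj₁ Φ v)
        essSurj  : ∀ (X : CObj) → Σ Rep λ π → CIso (F₀ π) X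

{-# OPTIONS --safe #-}
-- Every x ∈ G factors as (x // σ̃) ∙ σ̃ with σ = cls x and x // σ̃ ∈ H. Hence restriction is full:
-- a map equivariant for H and for the representatives σ̃ is G-equivariant. Conversely an object
-- (ρ, Ψ) extends to G by π(x) = ρ(x // σ̃) ∘ Ψ_σ; this is multiplicative because x y // (στ)~
-- telescopes into (x // σ̃) · σ̃ (y // τ̃) σ̃⁻¹ · h_{σ,τ}, and moving Ψ_σ past ρ(y // τ̃) and then
-- merging Ψ_σ Ψ_τ by the cocycle condition produces exactly these three factors.
module Submission where

open import Defs
open import Level using (Level)
open import Data.Product using (Σ; _,_; proj₁; proj₂)
open import Data.Fin using (Fin)
open import Algebra.Bundles using (Ring; Group)
open import Algebra.Module.Bundles using (LeftModule)
open import Relation.Binary.PropositionalEquality as ≡ using (_≡_; refl)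
import Algebra.Properties.Group as GroupProperties
import Algebra.Properties.Loop as LoopProperties
import Relation.Binary.Reasoning.Setoid as ≈-Reasoning

module GroupIdentities {g ℓ} (G : Group g ℓ) where
  open Group G
  open GroupProperties G using (\\-leftDividesʳ)
  open ≈-Reasoning setoid

  x//y∙[y∙z]≈x∙z : ∀ x y z → (x // y) ∙ (y ∙ z) ≈ x ∙ z
  x//y∙[y∙z]≈x∙z x y z = trans (assoc x (y ⁻¹) (y ∙ z)) (∙-congˡ (\\-leftDividesʳ y z))

  x⁻¹∙[x∙y//z]≈y//z : ∀ x y z → x ⁻¹ ∙ (x ∙ y // z) ≈ y // z
  x⁻¹∙[x∙y//z]≈y//z x y z = trans (sym (assoc (x ⁻¹) (x ∙ y) (z ⁻¹))) (∙-congʳ (\\-leftDividesʳ x y))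

  //-telescope : ∀ x X y Y Z → (x // X) ∙ ((X ∙ (y // Y) // X) ∙ (X ∙ Y // Z)) ≈ x ∙ y // Z
  //-telescope x X y Y Z = begin
    (x // X) ∙ ((X ∙ (y // Y) // X) ∙ (X ∙ Y // Z))   ≈⟨ ∙-congˡ (assoc (X ∙ (y // Y)) (X ⁻¹) _) ⟩
    (x // X) ∙ (X ∙ (y // Y) ∙ (X ⁻¹ ∙ (X ∙ Y // Z))) ≈⟨ ∙-congˡ (∙-congˡ (x⁻¹∙[x∙y//z]≈y//z X Y Z)) ⟩
    (x // X) ∙ (X ∙ (y // Y) ∙ (Y // Z))              ≈⟨ ∙-congˡ (assoc X (y // Y) (Y // Z)) ⟩
    (x // X) ∙ (X ∙ ((y // Y) ∙ (Y // Z)))            ≈⟨ ∙-congˡ (∙-congˡ (x//y∙[y∙z]≈x∙z y Y (Z ⁻¹))) ⟩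
    (x // X) ∙ (X ∙ (y // Z))                         ≈⟨ x//y∙[y∙z]≈x∙z x X (y // Z) ⟩
    x ∙ (y // Z)                                      ≈⟨ assoc x y (Z ⁻¹) ⟨
    x ∙ y // Z                                        ∎

module Cosets {g ℓg h} {G : Group g ℓg} {N : NormalSubgroup G h} (T : FiniteTransversal N) where
  open Group G
  open NormalSubgroup N
  open FiniteTransversal T
  open LoopProperties (GroupProperties.loop G) using (x//ε≈x)

  coset-factor∈H : ∀ x → H (x // rep (cls x))
  coset-factor∈H x = same→H x (rep (cls x)) (≡.sym (cls-rep (cls x)))

  cls-unique : ∀ {x σ} → H (x // rep σ) → cls x ≡ σ
  cls-unique {x} {σ} p = ≡.trans (H→same x (rep σ) p) (cls-rep σ)

  cls-∈H : ∀ {x} → H x → cls x ≡ cls ε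
  cls-∈H {x} p = H→same x ε (H-resp (sym (x//ε≈x x)) p)

  rep-cls-ε∈H : H (rep (cls ε))
  rep-cls-ε∈H = H-resp (x//ε≈x _) (same→H (rep (cls ε)) ε (cls-rep (cls ε)))

module Equivalence {a ℓa g ℓg h : Level}
  (A : Ring a ℓa) (G : Group g ℓg)
  (N : NormalSubgroup G h) (T : FiniteTransversal N)
  (m ℓm : Level) where

  open Constructions A G N T m ℓm
  open NormalSubgroup N
  open FiniteTransversal T
  open Cosets T
  open GroupIdentities G
  private module G = Group G
  open G using (_∙_; _⁻¹; _//_; ε)
  open GroupProperties G using (//-rightDividesˡ; //-rightDividesʳ)

  module ModuleReasoning (M : FGFree) where
    open LeftModule (FGFree.mod M) public using (≈ᴹ-refl; ≈ᴹ-sym; ≈ᴹ-trans; ≈ᴹ-reflexive)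
    open ≈-Reasoning (LeftModule.≈ᴹ-setoid (FGFree.mod M)) public

  id-isLinear : ∀ M → IsLinear M M (λ v → v)
  id-isLinear M = record { f-cong = λ e → e ; f-+ = λ _ _ → ≈ᴹ-refl ; f-* = λ _ _ → ≈ᴹ-refl }
    where open ModuleReasoning M

  ∘-isLinear : ∀ {M₁ M₂ M₃} {f : ∣ M₂ ∣ → ∣ M₃ ∣} {g : ∣ M₁ ∣ → ∣ M₂ ∣} →
               IsLinear M₂ M₃ f → IsLinear M₁ M₂ g → IsLinear M₁ M₃ (λ v → f (g v))
  ∘-isLinear {M₃ = M₃} {g = g} f-lin g-lin = record
    { f-cong = λ e → f.f-cong (g.f-cong e)
    ; f-+    = λ x y → ≈ᴹ-trans (f.f-cong (g.f-+ x y)) (f.f-+ (g x) (g y))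
    ; f-*    = λ c x → ≈ᴹ-trans (f.f-cong (g.f-* c x)) (f.f-* c (g x))
    }
    where
      open ModuleReasoning M₃
      module f = IsLinear f-lin
      module g = IsLinear g-lin

  module RepProperties (π : Rep) where
    open Rep π
    open ModuleReasoning M

    act-∙-cong : ∀ {x y z w} → x ∙ y G.≈ z ∙ w → ∀ v → Eq M (act x (act y v)) (act z (act w v))
    act-∙-cong {x} {y} {z} {w} xy≈zw v = begin
      act x (act y v) ≈⟨ act-∙ x y v ⟨
      act (x ∙ y) v   ≈⟨ act-cong xy≈zw v ⟩
      act (z ∙ w) v   ≈⟨ act-∙ z w v ⟩
      act z (act w v) ∎

    act-split : ∀ x y v → Eq M (act x v) (act (x // y) (act y v))
    act-split x y v = ≈ᴹ-trans (act-cong (G.sym (//-rightDividesˡ y x)) v) (act-∙ (x // y) y v)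

    act-cancel : ∀ {x y} → x ∙ y G.≈ ε → ∀ v → Eq M (act x (act y v)) v
    act-cancel {x} {y} xy≈ε v = ≈ᴹ-trans (≈ᴹ-sym (act-∙ x y v)) (≈ᴹ-trans (act-cong xy≈ε v) (act-ε v))

  F₀-wd : F-obj-wd
  F₀-wd π = record
    { ρ-lin     = λ x → act-lin (proj₁ x)
    ; ρ-cong    = λ _ _ x≈y → act-cong x≈y
    ; ρ-ε       = act-ε
    ; ρ-∙       = λ x y → act-∙ (proj₁ x) (proj₁ y)
    ; Ψ-lin     = λ σ → act-lin (rep σ)
    ; Ψ-eqv     = λ σ x → act-∙-cong (G.sym (//-rightDividesˡ (rep σ) (rep σ ∙ proj₁ x)))
    ; Ψ-inv     = λ σ → act (rep σ ⁻¹)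
    ; Ψ-inv-lin = λ σ → act-lin (rep σ ⁻¹)
    ; Ψ-inv-eqv = λ σ x → act-∙-cong (x⁻¹∙[x∙y//z]≈y//z (rep σ) (proj₁ x) (rep σ))
    ; Ψ-inv-l   = λ σ → act-cancel (G.inverseˡ (rep σ))
    ; Ψ-inv-r   = λ σ → act-cancel (G.inverseʳ (rep σ))
    ; cocycle   = λ σ τ → act-∙-cong (G.sym (//-rightDividesˡ (rep (σ · τ)) (rep σ ∙ rep τ)))
    }
    where open Rep π
          open RepProperties π

  F₁-wd : F-hom-wd
  F₁-wd π π' φ = record
    { Φ-lin = map-lin
    ; Φ-eqv = λ x → map-eqv (proj₁ x)
    ; Φ-Ψ   = λ σ v → ≈ᴹ-sym (map-eqv (rep σ) v)
    }
    where open RepHom φ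
          open ModuleReasoning (Rep.M π')

  F-full : ∀ π π' (Φ : CHom (F₀ F₀-wd F₁-wd π) (F₀ F₀-wd F₁-wd π')) →
           Σ (RepHom π π') λ φ → ∀ v → Eq (Rep.M π') (RepHom.map φ v) (proj₁ Φ v)
  F-full π π' (Φ , Φ-hom) = record { map = Φ ; map-lin = Φ-lin ; map-eqv = Φ-eqvᴳ } , λ _ → ≈ᴹ-refl
    where
      open CHomProps Φ-hom
      open ModuleReasoning (Rep.M π')
      module π  = Rep π
      module π' = Rep π'
      module Φ  = IsLinear Φ-lin

      Φ-eqvᴳ : ∀ x v → Eq (Rep.M π') (Φ (π.act x v)) (π'.act x (Φ v))
      Φ-eqvᴳ x v = begin
        Φ (π.act x v)                    ≈⟨ Φ.f-cong (RepProperties.act-split π x r v) ⟩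
        Φ (π.act (x // r) (π.act r v))   ≈⟨ Φ-eqv (x // r , coset-factor∈H x) (π.act r v) ⟩
        π'.act (x // r) (Φ (π.act r v))  ≈⟨ IsLinear.f-cong (π'.act-lin (x // r)) (Φ-Ψ (cls x) v) ⟨
        π'.act (x // r) (π'.act r (Φ v)) ≈⟨ RepProperties.act-split π' x r (Φ v) ⟨
        π'.act x (Φ v)                   ∎
        where r = rep (cls x)

  module Extension (X : CObj) where
    open CData (proj₁ X)
    open IsCObj (proj₂ X)
    open ModuleReasoning M
    module ρ x = IsLinear (ρ-lin x)
    module Ψ σ = IsLinear (Ψ-lin σ)

    coset-factor : G.Carrier → HEl
    coset-factor x = (x // rep (cls x) , coset-factor∈H x)

    act : G.Carrier → ∣ M ∣ → ∣ M ∣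
    act x v = ρ (coset-factor x) (Ψ (cls x) v)

    act-factor : ∀ x σ (p : H (x // rep σ)) v → Eq M (act x v) (ρ (x // rep σ , p) (Ψ σ v))
    act-factor x σ p = act-factor′ (cls-unique p) p
      where
        act-factor′ : ∀ {σ} → cls x ≡ σ → ∀ (p : H (x // rep σ)) v →
                      Eq M (act x v) (ρ (x // rep σ , p) (Ψ σ v))
        act-factor′ refl p v = ρ-cong _ _ G.refl _

    e : Fin k
    e = cls ε

    r : HEl
    r = (rep e , rep-cls-ε∈H)

    -- The representative of the trivial coset is only known to lie in H, so Ψ e need not be
    -- the identity; the cocycle condition at (e, e) and invertibility of Ψ e force Ψ e = ρ r.
    Ψ-e≈ρ-r : ∀ v → Eq M (Ψ e v) (ρ r v)
    Ψ-e≈ρ-r v = begin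
      Ψ e v                        ≈⟨ Ψ.f-cong e (Ψ-inv-r e v) ⟨
      Ψ e (Ψ e w)                  ≈⟨ cocycle e e w ⟩
      ρ (hst e e) (Ψ (e · e) w)    ≈⟨ ρ.f-cong (hst e e) (≈ᴹ-reflexive (≡.cong (λ σ → Ψ σ w) e·e≡e)) ⟩
      ρ (hst e e) (Ψ e w)          ≈⟨ ρ-cong (hst e e) r hst-e-e≈r (Ψ e w) ⟩
      ρ r (Ψ e w)                  ≈⟨ ρ.f-cong r (Ψ-inv-r e v) ⟩
      ρ r v                        ∎
      where
        w = Ψ-inv e v
        e·e≡e : e · e ≡ e
        e·e≡e = cls-∈H (H-∙ rep-cls-ε∈H rep-cls-ε∈H)
        hst-e-e≈r : proj₁ (hst e e) G.≈ rep e
        hst-e-e≈r = G.trans (G.∙-congˡ (G.⁻¹-cong (G.reflexive (≡.cong rep e·e≡e))))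
                            (//-rightDividesʳ (rep e) (rep e))

    act-on-H : ∀ x (x∈H : H x) v → Eq M (act x v) (ρ (x , x∈H) v)
    act-on-H x x∈H v = begin
      act x v                        ≈⟨ act-factor x e p v ⟩
      ρ (x // rep e , p) (Ψ e v)     ≈⟨ ρ.f-cong _ (Ψ-e≈ρ-r v) ⟩
      ρ (x // rep e , p) (ρ r v)     ≈⟨ ρ-∙ (x // rep e , p) r v ⟨
      ρ ((x // rep e) ∙ rep e , _) v ≈⟨ ρ-cong _ _ (//-rightDividesˡ (rep e) x) v ⟩
      ρ (x , x∈H) v                  ∎
      where p = H-∙ x∈H (H-⁻¹ rep-cls-ε∈H)

    act-rep : ∀ σ v → Eq M (act (rep σ) v) (Ψ σ v)
    act-rep σ v = begin
      act (rep σ) v                   ≈⟨ act-factor (rep σ) σ p v ⟩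
      ρ (rep σ // rep σ , p) (Ψ σ v)  ≈⟨ ρ-cong _ (ε , H-ε) (G.inverseʳ (rep σ)) (Ψ σ v) ⟩
      ρ (ε , H-ε) (Ψ σ v)             ≈⟨ ρ-ε (Ψ σ v) ⟩
      Ψ σ v                           ∎
      where p = H-resp (G.sym (G.inverseʳ (rep σ))) H-ε

    act-cong : ∀ {x y} → x G.≈ y → ∀ v → Eq M (act x v) (act y v)
    act-cong {x} {y} x≈y v = ≈ᴹ-trans (act-factor x (cls y) p v) (ρ-cong _ _ (G.∙-congʳ x≈y) _)
      where p = H-resp (G.∙-congʳ (G.sym x≈y)) (coset-factor∈H y)

    act-∙ : ∀ x y v → Eq M (act (x ∙ y) v) (act x (act y v))
    act-∙ x y v = begin
      act (x ∙ y) v                                       ≈⟨ act-factor (x ∙ y) (σ · τ) p v ⟩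
      ρ (x ∙ y // rep (σ · τ) , p) (Ψ (σ · τ) v)          ≈⟨ ρ-cong _ _ (G.sym telescope) _ ⟩
      ρ (hx ·ᴴ (conj (rep σ) hy ·ᴴ hst σ τ)) (Ψ (σ · τ) v) ≈⟨ ρ-∙ hx _ _ ⟩
      ρ hx (ρ (conj (rep σ) hy ·ᴴ hst σ τ) (Ψ (σ · τ) v))  ≈⟨ ρ.f-cong hx (ρ-∙ (conj (rep σ) hy) (hst σ τ) _) ⟩
      ρ hx (ρ (conj (rep σ) hy) (ρ (hst σ τ) (Ψ (σ · τ) v)))
        ≈⟨ ρ.f-cong hx (ρ.f-cong (conj (rep σ) hy) (cocycle σ τ v)) ⟨
      ρ hx (ρ (conj (rep σ) hy) (Ψ σ (Ψ τ v)))             ≈⟨ ρ.f-cong hx (Ψ-eqv σ hy (Ψ τ v)) ⟨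
      ρ hx (Ψ σ (ρ hy (Ψ τ v)))                            ∎
      where
        σ = cls x
        τ = cls y
        hx = coset-factor x
        hy = coset-factor y
        _·ᴴ_ : HEl → HEl → HEl
        (u , u∈H) ·ᴴ (w , w∈H) = (u ∙ w , H-∙ u∈H w∈H)
        telescope = //-telescope x (rep σ) y (rep τ) (rep (σ · τ))
        p = H-resp telescope (proj₂ (hx ·ᴴ (conj (rep σ) hy ·ᴴ hst σ τ)))

    π : Rep
    π = record
      { M        = M
      ; act      = act
      ; act-lin  = λ x → ∘-isLinear (ρ-lin (coset-factor x)) (Ψ-lin (cls x))
      ; act-cong = act-cong
      ; act-ε    = λ v → ≈ᴹ-trans (act-on-H ε H-ε v) (ρ-ε v)
      ; act-∙    = act-∙
      }

    F-π≅X : CIso (F₀ F₀-wd F₁-wd π) X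
    F-π≅X = ((λ v → v) , record { Φ-lin = id-isLinear M
                                ; Φ-eqv = λ x v → act-on-H (proj₁ x) (proj₂ x) v
                                ; Φ-Ψ   = λ σ v → ≈ᴹ-sym (act-rep σ v) })
          , ((λ v → v) , record { Φ-lin = id-isLinear M
                                ; Φ-eqv = λ x v → ≈ᴹ-sym (act-on-H (proj₁ x) (proj₂ x) v)
                                ; Φ-Ψ   = act-rep })
          , (λ _ → ≈ᴹ-refl) , (λ _ → ≈ᴹ-refl)

proposition2p1 : ∀ {a ℓa g ℓg h : Level}
    (A : Ring a ℓa) (G : Group g ℓg)
    (N : NormalSubgroup G h) (T : FiniteTransversal N)
    (m ℓm : Level) →
    Σ (Constructions.F-obj-wd A G N T m ℓm) λ wd₀ →
    Σ (Constructions.F-hom-wd A G N T m ℓm) λ wd₁ →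
    Constructions.IsEquivalence A G N T m ℓm wd₀ wd₁
proposition2p1 A G N T m ℓm = F₀-wd , F₁-wd , record
  { faithful = λ _ _ _ _ Fφ≈Fψ → Fφ≈Fψ
  ; full     = F-full
  ; essSurj  = λ X → Extension.π X , Extension.F-π≅X X
  }
  where open Equivalence A G N T m ℓm
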